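{- Let $Q$ be a cactus with $q\ge 2$ blocks. Let $u\in V(H)$ and $v\in V(H')$, where $H$ and $H'$ are two distinct cycles (blocks) of $Q$. Then the unique $u$–$v$ and $v$–$u$ directed paths in $Q$ have the forms $uQv=uHz\,Q\,z'H'v$ and $vQu=vH'z'\,Q\,zHu$, for some $z\in V(H)\cap K_Q$ and $z'\in V(H')\cap K_Q$. Furthermore, no arc or internal vertex of $zQz'$ belongs to $H$ or $H'$, and likewise for $z'Qz$.
   Context: Digraphs are finite, without loops or multiple arcs. A cactus is a strongly connected oriented graph (no pair of opposite arcs $uv,vu$) in which every arc belongs to exactly one directed cycle. A cut-vertex is a vertex whose removal disconnects the underlying graph; a block is a maximal subdigraph without a cut-vertex. In a cactus every block is a directed cycle, and between any ordered pair of vertices $x,y$ there is exactly one directed $x$–$y$ path, denoted $xQy$. $K_Q$ denotes the set of cut-vertices of $Q$. For a directed cycle $C$ and $x,y\in V(C)$, $xCy$ denotes the unique directed $x$–$y$ path in $C$ (a single vertex if $x=y$); juxtaposition such as $uHzQz'H'v$ denotes concatenation of paths. -}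

module Defs where

open import Data.Nat using (ℕ; _≥_)
open import Data.Fin using (Fin)
open import Data.Bool using (Bool; true; false)
open import Data.List using (List; []; _∷_; _++_; length; take; drop)
open import Data.List.Membership.Propositional using (_∈_; _∉_)
open import Data.List.Relation.Unary.Unique.Propositional using (Unique)
open import Data.Product using (Σ; ∃; ∃-syntax; _×_; _,_)
open import Data.Sum using (_⊎_)
open import Relation.Nullary using (¬_)
open import Relation.Binary.PropositionalEquality using (_≡_; _≢_)
open import Function.Bundles using (_⇔_)

Digraph : ℕ → Set
Digraph n = Fin n → Fin n → Bool

module _ {n : ℕ} where

  -- Walks along a binary relation R, recorded as the list of visited vertices
  -- (first vertex x, last vertex y). The trivial walk from x to x is [ x ].
  data Walk (R : Fin n → Fin n → Set) : Fin n → Fin n → List (Fin n) → Set where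
    single : ∀ {x} → Walk R x x (x ∷ [])
    step   : ∀ {x y z p} → R x y → Walk R y z p → Walk R x z (x ∷ p)

  PathAlong : (Fin n → Fin n → Set) → Fin n → Fin n → List (Fin n) → Set
  PathAlong R x y p = Walk R x y p × Unique p

  Arc : Digraph n → Fin n → Fin n → Set
  Arc G x y = G x y ≡ true

  IsPath : Digraph n → Fin n → Fin n → List (Fin n) → Set
  IsPath G = PathAlong (Arc G)

  ConsecArc : List (Fin n) → Fin n → Fin n → Set
  ConsecArc L a b = ∃[ xs ] ∃[ ys ] (L ≡ xs ++ (a ∷ b ∷ ys))

  Internal : List (Fin n) → Fin n → Set
  Internal L w = ∃[ xs ] ∃[ ys ] ((L ≡ xs ++ (w ∷ ys)) × (xs ≢ []) × (ys ≢ []))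

  -- A directed cycle v0 v1 ... v(k-1) is recorded as the list of its vertices;
  -- its arcs are v(i) v(i+1) and v(k-1) v0.
  CycArc : List (Fin n) → Fin n → Fin n → Set
  CycArc c = ConsecArc (c ++ take 1 c)

  IsDCycle : Digraph n → List (Fin n) → Set
  IsDCycle G c = (length c ≥ 2) × Unique c × (∀ x y → CycArc c x y → Arc G x y)

  -- two cycle representations are the same cycle (subdigraph) iff same arcs
  SameCycle : List (Fin n) → List (Fin n) → Set
  SameCycle c c' = ∀ x y → CycArc c x y ⇔ CycArc c' x y

  AdjAvoid : Digraph n → Fin n → Fin n → Fin n → Set
  AdjAvoid G v a b = (a ≢ v) × (b ≢ v) × (Arc G a b ⊎ Arc G b a)

  CutVertex : Digraph n → Fin n → Set
  CutVertex G v = ∃[ a ] ∃[ b ] ((a ≢ v) × (b ≢ v) × ¬ (∃[ p ] Walk (AdjAvoid G v) a b p))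

  record Cactus (G : Digraph n) : Set where
    field
      loopless   : ∀ x → G x x ≡ false
      oriented   : ∀ x y → Arc G x y → ¬ Arc G y x
      strong     : ∀ x y → ∃[ p ] IsPath G x y p
      arcInCycle : ∀ x y → Arc G x y → ∃[ c ] (IsDCycle G c × CycArc c x y)
      cycleUnique : ∀ x y c c' → IsDCycle G c → IsDCycle G c' →
                    CycArc c x y → CycArc c' x y → SameCycle c c'

  -- concatenation of paths xs (ending at z) and ys (starting at z)
  _⊙_ : List (Fin n) → List (Fin n) → List (Fin n)
  xs ⊙ ys = xs ++ drop 1 ys

  infixl 5 _⊙_

  AvoidsCycle : List (Fin n) → List (Fin n) → Set
  AvoidsCycle R H = (∀ a b → ConsecArc R a b → ¬ CycArc H a b) × (∀ w → Internal R w → w ∉ H)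

module Submission where

-- After generic facts on duplicate-free lists, walks, paths and cycles presented as
-- vertex lists, the cactus-specific core is the leaving lemma (leaves-along): a walk
-- from an out-neighbour of x ∈ H back to H that avoids x leaves x along an arc of H,
-- since closing it up along H yields a cycle sharing an arc with H, hence equal to H.
-- It implies that paths between vertices of a cycle follow the cycle, that paths are
-- unique, that a vertex of a cycle with an out-arc off the cycle is a cut-vertex, and
-- that distinct cycles share at most one vertex.  A path from H to H' is then cut at
-- its last vertex on H (exit) and the next vertex on H' (entry); comparing this
-- decomposition with that of the return path shows that the two exchange exit and
-- entry (bridges-meet), and the statement is read off the two decompositions.

open import Defs
open import Data.Nat using (ℕ; _≥_; s≤s; z≤n)
open import Data.Fin using (Fin; _≟_)
open import Data.List using (List; []; _∷_; _++_; [_]; take; length)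
open import Data.List.Properties using (++-assoc; ++-identityʳ; ++-cancelˡ; ∷-injective; ∷-injectiveˡ; ∷-injectiveʳ)
open import Data.List.Membership.Propositional using (_∈_; _∉_; lose)
open import Data.List.Membership.Propositional.Properties using (∈-++⁺ˡ; ∈-++⁺ʳ; ∈-++⁻; ∈-∃++)
import Data.List.Membership.DecPropositional as DecMembership
open import Data.List.Relation.Unary.Any using (Any; here; there; any?)
open import Data.List.Relation.Unary.All as All using (All; []; _∷_)
open import Data.List.Relation.Unary.All.Properties using (All¬⇒¬Any; ¬Any⇒All¬)
open import Data.List.Relation.Unary.AllPairs using ([]; _∷_)
open import Data.List.Relation.Unary.Unique.Propositional using (Unique)
import Data.List.Relation.Unary.Unique.Propositional.Properties as Unique
open import Data.Product using (∃-syntax; _×_; _,_; proj₁; proj₂)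
open import Data.Sum using (_⊎_; inj₁; inj₂; [_,_]′)
open import Data.Empty using (⊥-elim)
open import Function using (_∘_)
open import Function.Bundles using (mk⇔; Equivalence)
open import Relation.Nullary using (¬_; yes; no)
open import Relation.Unary using (Decidable)
open import Relation.Binary.PropositionalEquality using (_≡_; _≢_; refl; sym; trans; cong; subst; subst₂; ≢-sym; module ≡-Reasoning)

-- Duplicate-free lists and splitting lists at a vertex.
module _ {a} {A : Set a} where

  unique-head : ∀ {x} {xs : List A} → Unique (x ∷ xs) → x ∉ xs
  unique-head (x≢xs ∷ _) = All¬⇒¬Any x≢xs

  unique-++ˡ : ∀ (xs : List A) {ys} → Unique (xs ++ ys) → Unique xs
  unique-++ˡ [] _ = []
  unique-++ˡ (x ∷ xs) (x≢ ∷ u) = All.tabulate (λ i → All.lookup x≢ (∈-++⁺ˡ i)) ∷ unique-++ˡ xs u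

  unique-++ʳ : ∀ (xs : List A) {ys} → Unique (xs ++ ys) → Unique ys
  unique-++ʳ [] u = u
  unique-++ʳ (_ ∷ xs) (_ ∷ u) = unique-++ʳ xs u

  unique-disjoint : ∀ (xs : List A) {ys x} → Unique (xs ++ ys) → x ∈ xs → x ∉ ys
  unique-disjoint (_ ∷ xs) u (here refl) j = unique-head u (∈-++⁺ʳ xs j)
  unique-disjoint (_ ∷ xs) (_ ∷ u) (there i) j = unique-disjoint xs u i j

  unique-position : ∀ {L : List A} {x} xs xs' {ys ys'} → Unique L →
                    L ≡ xs ++ x ∷ ys → L ≡ xs' ++ x ∷ ys' → xs ≡ xs'
  unique-position [] [] _ _ _ = refl
  unique-position [] (_ ∷ xs') u refl e =
    ⊥-elim (unique-head u (subst (_ ∈_) (sym (∷-injectiveʳ e)) (∈-++⁺ʳ xs' (here refl))))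
  unique-position (_ ∷ xs) [] u refl e with refl , _ ← ∷-injective e =
    ⊥-elim (unique-head u (∈-++⁺ʳ xs (here refl)))
  unique-position (y ∷ xs) (_ ∷ xs') (_ ∷ u) refl e with refl , e' ← ∷-injective e =
    cong (y ∷_) (unique-position xs xs' u refl e')

  prefix-∈ : ∀ {z m : A} xs {ys} → z ∈ xs ++ [ m ] → z ∈ xs ++ m ∷ ys
  prefix-∈ xs z∈ with ∈-++⁻ xs z∈
  ... | inj₁ z∈xs = ∈-++⁺ˡ z∈xs
  ... | inj₂ (here refl) = ∈-++⁺ʳ xs (here refl)

  prefix-head : ∀ {m s : A} xs {ys q} zs → xs ++ m ∷ ys ≡ s ∷ q → ∃[ r ] (xs ++ m ∷ zs ≡ s ∷ r)
  prefix-head [] zs refl = zs , refl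
  prefix-head (_ ∷ xs) zs refl = xs ++ _ ∷ zs , refl

  split-first : ∀ {p} {P : A → Set p} → Decidable P → ∀ xs → Any P xs →
                ∃[ ys ] ∃[ z ] ∃[ zs ] (xs ≡ ys ++ z ∷ zs × P z × All (¬_ ∘ P) ys)
  split-first P? (x ∷ xs) any-P with P? x
  ... | yes Px = [] , x , xs , refl , Px , []
  split-first P? (x ∷ xs) (here Px) | no ¬Px = ⊥-elim (¬Px Px)
  split-first P? (x ∷ xs) (there any-P) | no ¬Px with split-first P? xs any-P
  ... | ys , z , zs , refl , Pz , before = x ∷ ys , z , zs , refl , Pz , ¬Px ∷ before

  split-last : ∀ {p} {P : A → Set p} → Decidable P → ∀ xs → Any P xs →
               ∃[ ys ] ∃[ z ] ∃[ zs ] (xs ≡ ys ++ z ∷ zs × P z × All (¬_ ∘ P) zs)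
  split-last P? (x ∷ xs) any-P with any? P? xs
  ... | yes any-xs with split-last P? xs any-xs
  ...   | ys , z , zs , refl , Pz , after = x ∷ ys , z , zs , refl , Pz , after
  split-last P? (x ∷ xs) (here Px) | no none = [] , x , xs , refl , Px , ¬Any⇒All¬ xs none
  split-last P? (x ∷ xs) (there any-P) | no none = ⊥-elim (none any-P)

  snoc-split : ∀ (L : List A) {e} xs {x a ys} → L ++ [ e ] ≡ xs ++ x ∷ a ∷ ys → ∃[ zs ] (L ≡ xs ++ x ∷ zs)
  snoc-split [] [] ()
  snoc-split [] (_ ∷ []) ()
  snoc-split [] (_ ∷ _ ∷ _) ()
  snoc-split (_ ∷ L) [] e with refl , _ ← ∷-injective e = L , refl
  snoc-split (_ ∷ L) (_ ∷ xs) e with refl , e' ← ∷-injective e with zs , refl ← snoc-split L xs e' = zs , refl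

-- Walks and paths along an arbitrary relation R.
module _ {n : ℕ} {R : Fin n → Fin n → Set} where
  open DecMembership (_≟_ {n = n}) using (_∈?_)

  walk-start : ∀ {x y p} → Walk R x y p → ∃[ q ] (p ≡ x ∷ q)
  walk-start single = [] , refl
  walk-start (step _ _) = _ , refl

  walk-head : ∀ {x y p} → Walk R x y p → x ∈ p
  walk-head single = here refl
  walk-head (step _ _) = here refl

  walk-end : ∀ {x y p} → Walk R x y p → y ∈ p
  walk-end single = here refl
  walk-end (step _ w) = there (walk-end w)

  walk-snoc : ∀ {x y p} → Walk R x y p → ∃[ q ] (p ≡ q ++ [ y ])
  walk-snoc single = [] , refl
  walk-snoc (step _ w) with walk-snoc w
  ... | q , refl = _ ∷ q , refl

  walk-split : ∀ xs {x y m ys} → Walk R x y (xs ++ m ∷ ys) → Walk R x m (xs ++ [ m ]) × Walk R m y (m ∷ ys)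
  walk-split [] single = single , single
  walk-split [] (step r w) = single , step r w
  walk-split (_ ∷ []) (step r w) = step r (proj₁ (walk-split [] w)) , proj₂ (walk-split [] w)
  walk-split (_ ∷ x ∷ xs) (step r w) = step r (proj₁ (walk-split (x ∷ xs) w)) , proj₂ (walk-split (x ∷ xs) w)

  walk-⊙ : ∀ {x y z p q} → Walk R x y p → Walk R y z q → Walk R x z (p ⊙ q)
  walk-⊙ single single = single
  walk-⊙ single (step r w) = step r w
  walk-⊙ (step r w) w' = step r (walk-⊙ w w')

  walk-arc : ∀ xs {x y p a b ys} → Walk R x y p → p ≡ xs ++ a ∷ b ∷ ys → R a b
  walk-arc [] single ()
  walk-arc [] (step r single) refl = r
  walk-arc [] (step r (step _ _)) refl = r
  walk-arc (_ ∷ []) single ()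
  walk-arc (_ ∷ _ ∷ _) single ()
  walk-arc (_ ∷ xs) (step _ w) e = walk-arc xs w (∷-injectiveʳ e)

  closed-path : ∀ {x p} → PathAlong R x x p → p ≡ [ x ]
  closed-path (single , _) = refl
  closed-path (step _ w , u) = ⊥-elim (unique-head u (walk-end w))

  path-split : ∀ xs {x y m ys P} → P ≡ xs ++ m ∷ ys → PathAlong R x y P →
               PathAlong R x m (xs ++ [ m ]) × PathAlong R m y (m ∷ ys)
  path-split xs {m = m} {ys} refl (w , u) =
    (proj₁ (walk-split xs w) , unique-++ˡ (xs ++ [ m ]) (subst Unique (sym (++-assoc xs [ m ] ys)) u)) ,
    (proj₂ (walk-split xs w) , unique-++ʳ xs u)

  path-extend : ∀ {x y y' P} → PathAlong R x y P → R y y' → y' ∉ P → PathAlong R x y' (P ++ [ y' ])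
  path-extend (w , u) r y'∉P = walk-⊙ w (step r single) , Unique.++⁺ u ([] ∷ []) λ { (i , here refl) → y'∉P i }

  last-arc : ∀ {y x p} → PathAlong R y x p → y ≢ x → ∃[ t ] ∃[ q ] (Walk R y t q × R t x × p ≡ q ++ [ x ])
  last-arc (single , _) y≢x = ⊥-elim (y≢x refl)
  last-arc {y} {x} (step {y = s} r w , _ ∷ u) y≢x with s ≟ x
  ... | yes refl = y , [ y ] , single , r , cong (y ∷_) (closed-path (w , u))
  ... | no s≢x with last-arc (w , u) s≢x
  ...   | t , q , wq , rt , refl = t , y ∷ q , step r wq , rt , refl

  loop-erase : ∀ {x y w} → Walk R x y w → ∃[ p ] (PathAlong R x y p × (∀ {a} → a ∈ p → a ∈ w))
  loop-erase single = _ , (single , [] ∷ []) , λ a∈p → a∈p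
  loop-erase {x} (step r w) with loop-erase w
  ... | p , path , p⊆w with x ∈? p
  ...   | yes x∈p with xs , ys , refl ← ∈-∃++ x∈p =
    x ∷ ys , proj₂ (path-split xs refl path) , there ∘ p⊆w ∘ ∈-++⁺ʳ xs
  ...   | no x∉p = x ∷ p , (step r (proj₁ path) , ¬Any⇒All¬ p x∉p ∷ proj₂ path) ,
    λ { (here refl) → here refl ; (there a∈p) → there (p⊆w a∈p) }

walk-map : ∀ {n} {R S : Fin n → Fin n → Set} → (∀ {a b} → R a b → S a b) →
           ∀ {x y p} → Walk R x y p → Walk S x y p
walk-map f single = single
walk-map f (step r w) = step (f r) (walk-map f w)

-- Vertex sequences: concatenation at a shared vertex, arcs and internal vertices.
module _ {n : ℕ} where

  ∈-⊙ : ∀ {z : Fin n} p {q} → z ∈ p ⊙ q → z ∈ p ⊎ z ∈ q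
  ∈-⊙ p {_ ∷ _} z∈ with ∈-++⁻ p z∈
  ... | inj₁ z∈p = inj₁ z∈p
  ... | inj₂ z∈q = inj₂ (there z∈q)
  ∈-⊙ p {[]} z∈ = inj₁ (subst (_ ∈_) (++-identityʳ p) z∈)

  ⊙-join : ∀ xs {z : Fin n} {q} → (xs ++ [ z ]) ⊙ (z ∷ q) ≡ xs ++ z ∷ q
  ⊙-join xs {z} {q} = ++-assoc xs [ z ] q

  regroup : ∀ A C {z z' : Fin n} {B D q} → z ∷ B ≡ C ++ z' ∷ D → C ++ [ z' ] ≡ z ∷ q →
            A ++ z ∷ B ≡ (A ++ [ z ]) ⊙ (C ++ [ z' ]) ⊙ (z' ∷ D)
  regroup A C {z} {z'} {B} {D} {q} split-B R≡ = begin
    A ++ z ∷ B                            ≡⟨ cong (A ++_) split-B ⟩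
    A ++ C ++ z' ∷ D                      ≡⟨ sym (++-assoc A C (z' ∷ D)) ⟩
    (A ++ C) ++ z' ∷ D                    ≡⟨ sym (⊙-join (A ++ C)) ⟩
    ((A ++ C) ++ [ z' ]) ⊙ (z' ∷ D)       ≡⟨ cong (_⊙ (z' ∷ D)) (++-assoc A C [ z' ]) ⟩
    (A ++ C ++ [ z' ]) ⊙ (z' ∷ D)         ≡⟨ cong (λ l → (A ++ l) ⊙ (z' ∷ D)) R≡ ⟩
    (A ++ z ∷ q) ⊙ (z' ∷ D)               ≡⟨ cong (_⊙ (z' ∷ D)) (sym (⊙-join A)) ⟩
    (A ++ [ z ]) ⊙ (z ∷ q) ⊙ (z' ∷ D)     ≡⟨ cong (λ l → (A ++ [ z ]) ⊙ l ⊙ (z' ∷ D)) (sym R≡) ⟩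
    (A ++ [ z ]) ⊙ (C ++ [ z' ]) ⊙ (z' ∷ D) ∎
    where open ≡-Reasoning

  consec-∈ : ∀ {L : List (Fin n)} {a b} → ConsecArc L a b → a ∈ L × b ∈ L
  consec-∈ (xs , _ , refl) = ∈-++⁺ʳ xs (here refl) , ∈-++⁺ʳ xs (there (here refl))

  consec-distinct : ∀ {L : List (Fin n)} {a b} → Unique L → ConsecArc L a b → a ≢ b
  consec-distinct u (xs , ys , refl) with (a≢ ∷ _) ∷ _ ← unique-++ʳ xs u = a≢

  end-not-internal : ∀ {L : List (Fin n)} {e} xs {ys} → Unique L → L ≡ xs ++ e ∷ ys →
                     xs ≡ [] ⊎ ys ≡ [] → ¬ Internal L e
  end-not-internal xs u e (inj₁ refl) (xs' , ys' , e' , xs'≢[] , _) =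
    xs'≢[] (sym (unique-position xs xs' u e e'))
  end-not-internal xs u e (inj₂ refl) (xs' , ys' , e' , _ , ys'≢[])
    with refl ← unique-position xs xs' u e e' = ys'≢[] (sym (∷-injectiveʳ (++-cancelˡ xs _ _ (trans (sym e) e'))))

-- Directed cycles presented as vertex lists c, with arcs c(i) → c(i+1) and last → first.
module _ {n : ℕ} where

  closing-⊆ : ∀ {z : Fin n} c → z ∈ c ++ take 1 c → z ∈ c
  closing-⊆ c z∈ with ∈-++⁻ c z∈
  ... | inj₁ z∈c = z∈c
  closing-⊆ (_ ∷ _) z∈ | inj₂ (here refl) = here refl

  cycArc-∈ : ∀ {c : List (Fin n)} {a b} → CycArc c a b → a ∈ c × b ∈ c
  cycArc-∈ {c} (xs , ys , e) = closing-⊆ c (subst (_ ∈_) (sym e) (∈-++⁺ʳ xs (here refl))) ,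
                               closing-⊆ c (subst (_ ∈_) (sym e) (∈-++⁺ʳ xs (there (here refl))))

  cycle-successor : ∀ {c : List (Fin n)} {x} → x ∈ c → ∃[ d ] CycArc c x d
  cycle-successor {c₀ ∷ cs} {x} x∈ with ∈-∃++ x∈
  ... | xs , [] , e = c₀ , xs , [] , trans (cong (_++ [ c₀ ]) e) (++-assoc xs [ x ] [ c₀ ])
  ... | xs , d ∷ ys , e = d , xs , ys ++ [ c₀ ] , trans (cong (_++ [ c₀ ]) e) (++-assoc xs (x ∷ d ∷ ys) [ c₀ ])

  cycle-successor-unique : ∀ {c : List (Fin n)} {x a b} → Unique c → CycArc c x a → CycArc c x b → a ≡ b
  cycle-successor-unique {[]} _ ([] , _ , ()) _
  cycle-successor-unique {[]} _ (_ ∷ _ , _ , ()) _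
  cycle-successor-unique {c@(_ ∷ _)} u (xs , _ , e) (xs' , _ , e')
    with _ , s ← snoc-split c xs e | _ , s' ← snoc-split c xs' e'
    with refl ← unique-position xs xs' u s s' =
    ∷-injectiveˡ (∷-injectiveʳ (++-cancelˡ xs _ _ (trans (sym e) e')))

  segment : ∀ {L : List (Fin n)} xs {x} mid {y ys} → L ≡ xs ++ x ∷ mid ++ y ∷ ys →
            Walk (ConsecArc L) x y (x ∷ mid ++ [ y ])
  segment xs [] e = step (xs , _ , e) single
  segment xs {x} (_ ∷ mid) e = step (xs , _ , e) (segment (xs ++ [ x ]) mid (trans e (sym (++-assoc xs [ x ] _))))

  cycle-walk : ∀ {H : List (Fin n)} {x y} → x ∈ H → y ∈ H → ∃[ w ] Walk (CycArc H) x y w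
  cycle-walk {h₀ ∷ hs} x∈ y∈ = _ , walk-⊙ (proj₂ (to-first x∈)) (proj₂ (from-first y∈))
    where
    to-first : ∀ {x} → x ∈ h₀ ∷ hs → ∃[ w ] Walk (CycArc (h₀ ∷ hs)) x h₀ w
    to-first {x} x∈ with xs , ys , e ← ∈-∃++ x∈ =
      _ , segment xs ys (trans (cong (_++ [ h₀ ]) e) (++-assoc xs (x ∷ ys) [ h₀ ]))
    from-first : ∀ {y} → y ∈ h₀ ∷ hs → ∃[ w ] Walk (CycArc (h₀ ∷ hs)) h₀ y w
    from-first (here refl) = _ , single
    from-first {y} (there y∈) with xs , ys , e ← ∈-∃++ y∈ =
      _ , segment [] xs (cong (h₀ ∷_) (trans (cong (_++ [ h₀ ]) e) (++-assoc xs (y ∷ ys) [ h₀ ])))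

  cycle-path : ∀ {H : List (Fin n)} {x y} → x ∈ H → y ∈ H → ∃[ p ] PathAlong (CycArc H) x y p
  cycle-path x∈ y∈ with p , path , _ ← loop-erase (proj₂ (cycle-walk x∈ y∈)) = p , path

  along-⊆ : ∀ {H : List (Fin n)} {x y p z} → x ∈ H → Walk (CycArc H) x y p → z ∈ p → z ∈ H
  along-⊆ x∈ single (here refl) = x∈
  along-⊆ x∈ (step _ _) (here refl) = x∈
  along-⊆ _ (step arc w) (there z∈) = along-⊆ (proj₂ (cycArc-∈ arc)) w z∈

  avoids-but-end : ∀ {L H : List (Fin n)} {e} xs {ys} → Unique L → L ≡ xs ++ e ∷ ys → xs ≡ [] ⊎ ys ≡ [] →
                   (∀ {w} → w ∈ L → w ∈ H → w ≡ e) → AvoidsCycle L H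
  avoids-but-end {L} {H} xs u L≡ at-end only-e = no-arc , no-internal
    where
    no-arc : ∀ a b → ConsecArc L a b → ¬ CycArc H a b
    no-arc a b a→b on-H = consec-distinct u a→b (trans (only-e (proj₁ (consec-∈ a→b)) (proj₁ (cycArc-∈ on-H)))
                                                       (sym (only-e (proj₂ (consec-∈ a→b)) (proj₂ (cycArc-∈ on-H)))))
    no-internal : ∀ w → Internal L w → w ∉ H
    no-internal w internal@(xs' , _ , refl , _) w∈H =
      end-not-internal xs u L≡ at-end (subst (Internal L) (only-e (∈-++⁺ʳ xs' (here refl)) w∈H) internal)

  different-sym : ∀ {H H' : List (Fin n)} → ¬ SameCycle H H' → ¬ SameCycle H' H
  different-sym H≠H' same = H≠H' λ x y → mk⇔ (Equivalence.from (same x y)) (Equivalence.to (same x y))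

-- Paths and cycles in a fixed cactus G.
module CactusPaths {n : ℕ} (G : Digraph n) (cactus : Cactus G) where
  open Cactus cactus
  open DecMembership (_≟_ {n = n}) using (_∈?_)

  cycle-arc : ∀ {H} → IsDCycle G H → ∀ {a b} → CycArc H a b → Arc G a b
  cycle-arc (_ , _ , arcs) = arcs _ _

  no-loop : ∀ {x} → ¬ Arc G x x
  no-loop {x} x→x with trans (sym (loopless x)) x→x
  ... | ()

  close-cycle : ∀ {x y'} M T → IsPath G x y' (x ∷ M ++ [ y' ]) → IsPath G y' x (y' ∷ T ++ [ x ]) →
                (∀ {w} → w ∈ M → w ∉ y' ∷ T) → IsDCycle G (x ∷ M ++ y' ∷ T)
  close-cycle {x} {y'} M T (wM , x-fresh ∷ uM) (wT , uT) disjoint = two-vertices M , unique , arcs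
    where
    two-vertices : ∀ M → length (x ∷ M ++ y' ∷ T) ≥ 2
    two-vertices [] = s≤s (s≤s z≤n)
    two-vertices (_ ∷ _) = s≤s (s≤s z≤n)
    x∉ : x ∉ M ++ y' ∷ T
    x∉ x∈ with ∈-++⁻ M x∈
    ... | inj₁ x∈M = All¬⇒¬Any x-fresh (∈-++⁺ˡ x∈M)
    ... | inj₂ x∈T = unique-disjoint (y' ∷ T) uT x∈T (here refl)
    unique : Unique (x ∷ M ++ y' ∷ T)
    unique = ¬Any⇒All¬ _ x∉ ∷ Unique.++⁺ (unique-++ˡ M uM) (unique-++ˡ (y' ∷ T) uT) λ (i , j) → disjoint i j
    closed : Walk (Arc G) x x (x ∷ (M ++ y' ∷ T) ++ [ x ])
    closed = subst (Walk (Arc G) x x) (cong (x ∷_) (trans (⊙-join M) (sym (++-assoc M (y' ∷ T) [ x ])))) (walk-⊙ wM wT)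
    arcs : ∀ a b → CycArc (x ∷ M ++ y' ∷ T) a b → Arc G a b
    arcs a b (xs , ys , e) = walk-arc xs closed e

  -- Let x, y be vertices of the cycle H and let x → s ⋯ y
  -- be a path.  Let y' be its first vertex after x on H.  Closing x → s ⋯ y' by the
  -- path of H from y' to x gives a directed cycle C sharing the arc y' → h with H; as
  -- arcs lie on unique cycles, C is H, and so x → s is an arc of H.
  leaves-along-path : ∀ {H x y s p} → IsDCycle G H → x ∈ H → y ∈ H →
                      Arc G x s → IsPath G s y p → x ∉ p → CycArc H x s
  leaves-along-path {H} {x} {s = s} {p} dH x∈H y∈H x→s path@(w , _) x∉p
    with M , y' , rest , p≡ , y'∈H , M∉H ← split-first (_∈? H) p (lose (walk-end w) y∈H)
    with cycle-path y'∈H x∈H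
  ... | _ , (single , _) = ⊥-elim (x∉p (subst (_ ∈_) (sym p≡) (∈-++⁺ʳ M (here refl))))
  ... | _ , (step {y = h} y'→h wT , uT) with T , refl ← walk-snoc wT =
    Equivalence.to (cycleUnique y' h C H dC dH y'→h-on-C y'→h x s) x→s-on-C
    where
    to-y' : IsPath G x y' (x ∷ M ++ [ y' ])
    to-y' with w' , u' ← proj₁ (path-split M p≡ path) =
      step x→s w' , ¬Any⇒All¬ _ (x∉p ∘ subst (_ ∈_) (sym p≡) ∘ prefix-∈ M) ∷ u'
    back : IsPath G y' x (y' ∷ T ++ [ x ])
    back = walk-map (cycle-arc dH) (step y'→h wT) , uT
    disjoint : ∀ {v} → v ∈ M → v ∉ y' ∷ T
    disjoint v∈M v∈T = All.lookup M∉H v∈M (along-⊆ y'∈H (step y'→h wT) (∈-++⁺ˡ v∈T))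
    C : List (Fin n)
    C = x ∷ M ++ y' ∷ T
    dC : IsDCycle G C
    dC = close-cycle M T to-y' back disjoint
    y'→h-on-C : CycArc C y' h
    y'→h-on-C with q , e ← walk-start wT =
      x ∷ M , q , cong (x ∷_) (trans (++-assoc M (y' ∷ T) [ x ]) (cong (λ t → M ++ y' ∷ t) e))
    x→s-on-C : CycArc C x s
    x→s-on-C with q , e ← walk-start w with r , e' ← prefix-head M T (trans (sym p≡) e) =
      [] , r ++ [ x ] , cong (λ l → x ∷ l ++ [ x ]) e'

  leaves-along : ∀ {H x y s w} → IsDCycle G H → x ∈ H → y ∈ H →
                 Arc G x s → Walk (Arc G) s y w → x ∉ w → CycArc H x s
  leaves-along dH x∈H y∈H x→s w x∉w with _ , path , p⊆w ← loop-erase w =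
    leaves-along-path dH x∈H y∈H x→s path (x∉w ∘ p⊆w)

  path-along-cycle : ∀ {H x y p} → IsDCycle G H → x ∈ H → y ∈ H → IsPath G x y p → Walk (CycArc H) x y p
  path-along-cycle dH x∈H y∈H (single , _) = single
  path-along-cycle {H} {x} dH x∈H y∈H (step {y = s} x→s w , x∉p ∷ u) =
    step x→s-on-H (path-along-cycle dH (proj₂ (cycArc-∈ x→s-on-H)) y∈H (w , u))
    where
    x→s-on-H : CycArc H x s
    x→s-on-H = leaves-along dH x∈H y∈H x→s w (All¬⇒¬Any x∉p)

  -- Given y ≠ x, let t → x be the last arc of a path from y to x and D its cycle.  Any
  -- route x → c ⋯ y avoiding x continues along y ⋯ t, so x → c lies on D.
  return-cycle : ∀ {x y} → y ≢ x →
                 ∃[ D ] (Unique D × (∀ {c r} → Arc G x c → Walk (Arc G) c y r → x ∉ r → CycArc D x c))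
  return-cycle {x} {y} y≢x with T , back ← strong y x with t , w , y→t , t→x , refl ← last-arc back y≢x
    with D , dD@(_ , uD , _) , t→x-on-D ← arcInCycle t x t→x =
    D , uD , λ {_} {r} x→c c⇝y x∉r → leaves-along dD (proj₂ (cycArc-∈ t→x-on-D)) (proj₁ (cycArc-∈ t→x-on-D))
      x→c (walk-⊙ c⇝y y→t) λ x∈ → [ x∉r , x∉w ]′ (∈-⊙ r x∈)
    where
    x∉w : x ∉ w
    x∉w x∈w = unique-disjoint w (proj₂ back) x∈w (here refl)

  -- Hence two routes from x to y leave x by the same arc (the successor of x on D).
  same-first-arc : ∀ {x y a b p q} → Arc G x a → Walk (Arc G) a y p → x ∉ p →
                   Arc G x b → Walk (Arc G) b y q → x ∉ q → a ≡ b
  same-first-arc x→a a⇝y x∉p x→b b⇝y x∉q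
    with D , uD , on-D ← return-cycle (λ { refl → x∉p (walk-end a⇝y) }) =
    cycle-successor-unique uD (on-D x→a a⇝y x∉p) (on-D x→b b⇝y x∉q)

  path-unique : ∀ {x y P P'} → IsPath G x y P → IsPath G x y P' → P ≡ P'
  path-unique (single , _) path' = sym (closed-path path')
  path-unique path@(step _ _ , _) (single , _) = closed-path path
  path-unique (step x→a w , x∉p ∷ u) (step x→b w' , x∉p' ∷ u')
    with refl ← same-first-arc x→a w (All¬⇒¬Any x∉p) x→b w' (All¬⇒¬Any x∉p') =
    cong (_ ∷_) (path-unique (w , u) (w' , u'))

  -- StartsWith x y s: the path from x to y (unique, by path-unique) begins with x → s.
  StartsWith : Fin n → Fin n → Fin n → Set
  StartsWith x y s = ∃[ q ] IsPath G x y (x ∷ s ∷ q)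

  starts-forward : ∀ {x y y' s} → y' ≢ x → Arc G y y' → StartsWith x y s → StartsWith x y' s
  starts-forward {x} {y' = y'} {s} y'≢x y→y' (q , path) with y' ∈? (x ∷ s ∷ q)
  ... | no y'∉ = q ++ [ y' ] , path-extend path y→y' y'∉
  ... | yes y'∈ with ∈-∃++ y'∈
  ...   | [] , _ , e = ⊥-elim (y'≢x (sym (∷-injectiveˡ e)))
  ...   | _ ∷ xs , ys , e with refl , e' ← ∷-injective e with r , e'' ← prefix-head xs [] (sym e') =
    r , subst (IsPath G x y') (cong (x ∷_) e'') (proj₁ (path-split (x ∷ xs) e path))

  starts-backward : ∀ {x y y' s} → y ≢ x → y' ≢ x → Arc G y' y → StartsWith x y s → StartsWith x y' s
  starts-backward {x} {y' = y'} y≢x y'≢x y'→y (q , path) with strong x y'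
  ... | _ , (single , _) = ⊥-elim (y'≢x refl)
  ... | _ , path'@(step _ w , _) with q' , refl ← walk-start w
    with q'' , path'' ← starts-forward y≢x y'→y (q' , path')
    with refl ← path-unique path path'' = q' , path'

  starts-along : ∀ {x a b p s} → Walk (AdjAvoid G x) a b p → StartsWith x a s → StartsWith x b s
  starts-along single starts = starts
  starts-along (step (_ , b≢x , inj₁ a→b) w) starts = starts-along w (starts-forward b≢x a→b starts)
  starts-along (step (a≢x , b≢x , inj₂ b→a) w) starts = starts-along w (starts-backward a≢x b≢x b→a starts)

  -- A vertex x of a cycle H with an out-arc x → c off H is a cut-vertex: c and the
  -- successor d of x on H are separated in G - x, since paths from x to vertices of
  -- one component of G - x all start with the same arc.
  cut-vertex : ∀ {H x c} → IsDCycle G H → x ∈ H → Arc G x c → ¬ CycArc H x c → CutVertex G x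
  cut-vertex {x = x} {c} dH x∈H x→c x→c∉H with d , x→d ← cycle-successor x∈H =
    c , d , c≢x , d≢x , separated
    where
    c≢x : c ≢ x
    c≢x refl = no-loop x→c
    d≢x : d ≢ x
    d≢x refl = no-loop (cycle-arc dH x→d)
    arc-path : ∀ {e} → Arc G x e → e ≢ x → StartsWith x e e
    arc-path x→e e≢x = [] , step x→e single , ((≢-sym e≢x ∷ []) ∷ [] ∷ [])
    separated : ¬ (∃[ p ] Walk (AdjAvoid G x) c d p)
    separated (_ , c⇝d) with _ , path ← starts-along c⇝d (arc-path x→c c≢x)
      with refl ← path-unique path (proj₂ (arc-path (cycle-arc dH x→d) d≢x)) = x→c∉H x→d

  -- Two different cycles share at most one vertex: a second common vertex y would let
  -- the path along H' from x to y leave x along an arc of H as well.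
  meet-at-most-once : ∀ {H H' x y} → IsDCycle G H → IsDCycle G H' → ¬ SameCycle H H' →
                      x ∈ H → x ∈ H' → y ∈ H → y ∈ H' → x ≡ y
  meet-at-most-once {H} {H'} {x} {y} dH dH' H≠H' x∈H x∈H' y∈H y∈H' with x ≟ y
  ... | yes x≡y = x≡y
  ... | no x≢y with cycle-path x∈H' y∈H'
  ...   | _ , (single , _) = ⊥-elim (x≢y refl)
  ...   | _ , (step {y = s} x→s w , x∉ ∷ _) = ⊥-elim (H≠H' (cycleUnique x s H H' dH dH' x→s-on-H x→s))
    where
    x→s-on-H : CycArc H x s
    x→s-on-H = leaves-along dH x∈H y∈H (cycle-arc dH' x→s) (walk-map (cycle-arc dH') w) (All¬⇒¬Any x∉)

  record Bridge (H H' : List (Fin n)) (s t : Fin n) (P : List (Fin n)) : Set where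
    field
      exit entry : Fin n
      p₁ R p₃ : List (Fin n)
      exit∈H : exit ∈ H
      entry∈H' : entry ∈ H'
      along-H : PathAlong (CycArc H) s exit p₁
      bridge : IsPath G exit entry R
      along-H' : PathAlong (CycArc H') entry t p₃
      splits : P ≡ p₁ ⊙ R ⊙ p₃
      meets-H-at-exit : ∀ {w} → w ∈ R → w ∈ H → w ≡ exit
      meets-H'-at-entry : ∀ {w} → w ∈ R → w ∈ H' → w ≡ entry

  decompose : ∀ {H H' u v P} → IsDCycle G H → IsDCycle G H' → u ∈ H → v ∈ H' → IsPath G u v P → Bridge H H' u v P
  decompose {H} {H'} {u} {v} {P} dH dH' u∈H v∈H' path
    with A , z , B , P≡ , z∈H , B∉H ← split-last (_∈? H) P (lose (walk-head (proj₁ path)) u∈H)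
    with to-z , from-z ← path-split A P≡ path
    with C , z' , D , zB≡ , z'∈H' , C∉H' ← split-first (_∈? H') (z ∷ B) (lose (walk-end (proj₁ from-z)) v∈H')
    with bridge , from-z' ← path-split C zB≡ from-z
    with q , R≡ ← walk-start (proj₁ bridge) = record
      { exit = z ; entry = z' ; p₁ = A ++ [ z ] ; R = C ++ [ z' ] ; p₃ = z' ∷ D
      ; exit∈H = z∈H ; entry∈H' = z'∈H'
      ; along-H = path-along-cycle dH u∈H z∈H to-z , proj₂ to-z
      ; bridge = bridge
      ; along-H' = path-along-cycle dH' z'∈H' v∈H' from-z' , proj₂ from-z'
      ; splits = trans P≡ (regroup A C zB≡ R≡)
      ; meets-H-at-exit = λ w∈R w∈H → only-z (subst (_ ∈_) (sym zB≡) (prefix-∈ C w∈R)) w∈H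
      ; meets-H'-at-entry = only-z'
      }
    where
    only-z : ∀ {w} → w ∈ z ∷ B → w ∈ H → w ≡ z
    only-z (here refl) _ = refl
    only-z (there w∈B) w∈H = ⊥-elim (All.lookup B∉H w∈B w∈H)
    only-z' : ∀ {w} → w ∈ C ++ [ z' ] → w ∈ H' → w ≡ z'
    only-z' w∈R w∈H' with ∈-++⁻ C w∈R
    ... | inj₁ w∈C = ⊥-elim (All.lookup C∉H' w∈C w∈H')
    ... | inj₂ (here refl) = refl

  module _ {H H' s t P} (d : Bridge H H' s t P) where
    open Bridge d

    bridge-avoids-H : AvoidsCycle R H
    bridge-avoids-H with _ , R≡ ← walk-start (proj₁ bridge) =
      avoids-but-end [] (proj₂ bridge) R≡ (inj₁ refl) meets-H-at-exit

    bridge-avoids-H' : AvoidsCycle R H'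
    bridge-avoids-H' with q , R≡ ← walk-snoc (proj₁ bridge) =
      avoids-but-end q (proj₂ bridge) R≡ (inj₂ refl) meets-H'-at-entry

    -- The exit vertex is a cut-vertex: it has an out-arc off H, namely the first arc of
    -- the bridge, or, if the bridge is trivial, the arc of H' leaving exit = entry.
    exit-cut : IsDCycle G H → IsDCycle G H' → ¬ SameCycle H H' → CutVertex G exit
    exit-cut dH dH' H≠H' with exit ≟ entry | bridge
    ... | yes refl | _ with e , x→e ← cycle-successor entry∈H' =
      cut-vertex dH exit∈H (cycle-arc dH' x→e) λ on-H → H≠H' (cycleUnique _ _ H H' dH dH' on-H x→e)
    ... | no exit≢entry | single , _ = ⊥-elim (exit≢entry refl)
    ... | no _ | step x→r w , x∉ ∷ _ = cut-vertex dH exit∈H x→r λ on-H →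
      All¬⇒¬Any x∉ (subst (_∈ _) (meets-H-at-exit (there (walk-head w)) (proj₂ (cycArc-∈ on-H))) (walk-head w))

  module _ {H H' u v P P'} (dH : IsDCycle G H) (dH' : IsDCycle G H') (v∈H' : v ∈ H')
           (d₁ : Bridge H H' u v P) (d₂ : Bridge H' H v u P') where
    private
      module B₁ = Bridge d₁
      module B₂ = Bridge d₂

    -- If the bridge of the path from H to H' is nontrivial, exit → r ⋯ entry, then the
    -- return path re-enters H at exit: otherwise r ⋯ entry ⋯ v ⋯ (return bridge) would be
    -- a walk avoiding exit from r back to H, so exit → r would lie on H by the leaving
    -- lemma, contradicting that the bridge meets H only at exit.
    return-meets-exit : B₁.exit ≢ B₁.entry → B₂.entry ≡ B₁.exit
    return-meets-exit exit≢entry with B₂.entry ≟ B₁.exit | B₁.bridge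
    ... | yes e | _ = e
    ... | no _ | single , _ = ⊥-elim (exit≢entry refl)
    ... | no entry₂≢exit₁ | step {y = r} {p = rest} z→r w , z∉rest ∷ _ =
      ⊥-elim (All¬⇒¬Any z∉rest (subst (_∈ rest) r≡z (walk-head w)))
      where
      z : Fin n
      z = B₁.exit
      detour : Walk (Arc G) r B₂.entry (rest ⊙ B₁.p₃ ⊙ B₂.p₁ ⊙ B₂.R)
      detour = walk-⊙ (walk-⊙ (walk-⊙ w (walk-map (cycle-arc dH') (proj₁ B₁.along-H')))
                              (walk-map (cycle-arc dH') (proj₁ B₂.along-H))) (proj₁ B₂.bridge)
      on-H' : z ∈ H' → z ≡ B₁.entry
      on-H' = B₁.meets-H'-at-entry (here refl)
      z∉detour : z ∉ rest ⊙ B₁.p₃ ⊙ B₂.p₁ ⊙ B₂.R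
      z∉detour z∈ with ∈-⊙ _ z∈
      ... | inj₂ z∈R₂ = entry₂≢exit₁ (sym (B₂.meets-H'-at-entry z∈R₂ B₁.exit∈H))
      ... | inj₁ z∈ with ∈-⊙ _ z∈
      ... | inj₂ z∈p₁ = exit≢entry (on-H' (along-⊆ v∈H' (proj₁ B₂.along-H) z∈p₁))
      ... | inj₁ z∈ with ∈-⊙ rest z∈
      ... | inj₂ z∈p₃ = exit≢entry (on-H' (along-⊆ B₁.entry∈H' (proj₁ B₁.along-H') z∈p₃))
      ... | inj₁ z∈rest = All¬⇒¬Any z∉rest z∈rest
      r≡z : r ≡ z
      r≡z = B₁.meets-H-at-exit (there (walk-head w))
              (proj₂ (cycArc-∈ (leaves-along dH B₁.exit∈H B₂.entry∈H' z→r detour z∉detour)))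

  module _ {H H' u v P P'} (dH : IsDCycle G H) (dH' : IsDCycle G H') (H≠H' : ¬ SameCycle H H')
           (u∈H : u ∈ H) (v∈H' : v ∈ H') (d₁ : Bridge H H' u v P) (d₂ : Bridge H' H v u P') where
    private
      module B₁ = Bridge d₁
      module B₂ = Bridge d₂

    -- The return path re-enters H where the path left it.  For a nontrivial bridge this
    -- is return-meets-exit.  For a trivial one (exit = entry ∈ H ∩ H'), a nontrivial
    -- return bridge would, by return-meets-exit for the return path, start at a vertex
    -- of H, which it meets only at its end; so it is trivial too, and both meeting
    -- points lie on H ∩ H', a single vertex.
    bridges-meet : B₂.entry ≡ B₁.exit
    bridges-meet with B₁.exit ≟ B₁.entry
    ... | no exit≢entry₁ = return-meets-exit dH dH' v∈H' d₁ d₂ exit≢entry₁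
    ... | yes exit≡entry₁ with B₂.exit ≟ B₂.entry
    ...   | no exit≢entry₂ = ⊥-elim (exit≢entry₂ (B₂.meets-H'-at-entry (walk-head (proj₁ B₂.bridge)) exit₂∈H))
      where
      exit₂∈H : B₂.exit ∈ H
      exit₂∈H = subst (_∈ H) (trans exit≡entry₁ (return-meets-exit dH' dH u∈H d₂ d₁ exit≢entry₂)) B₁.exit∈H
    ...   | yes exit≡entry₂ = meet-at-most-once dH dH' H≠H'
      B₂.entry∈H' (subst (_∈ H') exit≡entry₂ B₂.exit∈H) B₁.exit∈H (subst (_∈ H') (sym exit≡entry₁) B₁.entry∈H')

lemma22 : ∀ {n : ℕ} (G : Digraph n) → Cactus G →
    (H H' : List _) → IsDCycle G H → IsDCycle G H' → ¬ SameCycle H H' →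
    ∀ u v → u ∈ H → v ∈ H' →
    ∀ P P' → IsPath G u v P → IsPath G v u P' →
    ∃[ z ] ∃[ z' ] ∃[ p₁ ] ∃[ R ] ∃[ p₃ ] ∃[ q₁ ] ∃[ R' ] ∃[ q₃ ]
      ( z ∈ H × CutVertex G z × z' ∈ H' × CutVertex G z'
      × PathAlong (CycArc H) u z p₁ × IsPath G z z' R × PathAlong (CycArc H') z' v p₃
      × P ≡ p₁ ⊙ R ⊙ p₃
      × PathAlong (CycArc H') v z' q₁ × IsPath G z' z R' × PathAlong (CycArc H) z u q₃
      × P' ≡ q₁ ⊙ R' ⊙ q₃
      × AvoidsCycle R H × AvoidsCycle R H' × AvoidsCycle R' H × AvoidsCycle R' H' )
lemma22 G cactus H H' dH dH' H≠H' u v u∈H v∈H' P P' path path' =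
  B₁.exit , B₁.entry , B₁.p₁ , B₁.R , B₁.p₃ , B₂.p₁ , B₂.R , B₂.p₃ ,
  B₁.exit∈H , exit-cut d₁ dH dH' H≠H' , B₁.entry∈H' , subst (CutVertex G) exit₂≡entry₁ (exit-cut d₂ dH' dH H'≠H) ,
  B₁.along-H , B₁.bridge , B₁.along-H' , B₁.splits ,
  subst (λ z' → PathAlong (CycArc H') v z' B₂.p₁) exit₂≡entry₁ B₂.along-H ,
  subst₂ (λ z' z → IsPath G z' z B₂.R) exit₂≡entry₁ entry₂≡exit₁ B₂.bridge ,
  subst (λ z → PathAlong (CycArc H) z u B₂.p₃) entry₂≡exit₁ B₂.along-H' ,
  B₂.splits ,
  bridge-avoids-H d₁ , bridge-avoids-H' d₁ , bridge-avoids-H' d₂ , bridge-avoids-H d₂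
  where
  open CactusPaths G cactus
  H'≠H : ¬ SameCycle H' H
  H'≠H = different-sym {H = H} {H'} H≠H'
  d₁ : Bridge H H' u v P
  d₁ = decompose dH dH' u∈H v∈H' path
  d₂ : Bridge H' H v u P'
  d₂ = decompose dH' dH v∈H' u∈H path'
  module B₁ = Bridge d₁
  module B₂ = Bridge d₂
  entry₂≡exit₁ : B₂.entry ≡ B₁.exit
  entry₂≡exit₁ = bridges-meet dH dH' H≠H' u∈H v∈H' d₁ d₂
  exit₂≡entry₁ : B₂.exit ≡ B₁.entry
  exit₂≡entry₁ = sym (bridges-meet dH' dH H'≠H v∈H' u∈H d₂ d₁)
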